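{- Let $\Gamma\vdash M:A$ be derivable in the simply typed $\lambda$-calculus. Then $\Gamma^{\mathsf p}\vdash M^{\mathrm v}:A^{\mathsf q}$ is derivable in the ptq type system.
   Context: Simply typed $\lambda$-calculus over implicational types $A::=X\mid A\to A$. For $\Gamma=x_1:A_1,\dots,x_n:A_n$, $\Gamma^{\mathsf p}=x_1:A_1^{\mathsf p},\dots,x_n:A_n^{\mathsf p}$. ptq-calculus: terms built from p-variables (identified with $\lambda$-variables), a t-variable $k$ and a constant $*$; p-terms $p::=x\mid\lambda\langle x,k\rangle.u\mid\lambda k.u$; t-terms $t::=*\mid k\mid\langle p,t\rangle\mid\lambda x.u$; q-terms $q::=\overline{\lambda}k.u$; e-terms $u::=t;p\mid q\,t$. Types $A^{\mathsf p},A^{\mathsf t},A^{\mathsf q}$. Environments $\Gamma$ or $\Gamma\rhd\delta$, $\Gamma$ a set of distinct p-variables with proof types, $\delta$ either $k:A^{\mathsf t}$ or $*:A^{\mathsf t}$. Rules: $\Gamma,x:A^{\mathsf p}\vdash x:A^{\mathsf p}$; $\Gamma\rhd k:A^{\mathsf t}\vdash k:A^{\mathsf t}$; $\Gamma\rhd *:A^{\mathsf t}\vdash *:A^{\mathsf t}$; $\Gamma,x:A^{\mathsf p}\rhd k:B^{\mathsf t}\vdash u\Rightarrow\Gamma\vdash\lambda\langle x,k\rangle.u:(A\to B)^{\mathsf p}$; $\Gamma\vdash p:A^{\mathsf p},\ \Gamma\rhd\delta\vdash t:B^{\mathsf t}\Rightarrow\Gamma\rhd\delta\vdash\langle p,t\rangle:(A\to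 B)^{\mathsf t}$; $\Gamma\rhd k:A^{\mathsf t}\vdash u\Rightarrow\Gamma\vdash\lambda k.u:A^{\mathsf p}$; $\Gamma,x:A^{\mathsf p}\rhd\delta\vdash u\Rightarrow\Gamma\rhd\delta\vdash\lambda x.u:A^{\mathsf t}$; $\Gamma\rhd k:A^{\mathsf t}\vdash u\Rightarrow\Gamma\vdash\overline\lambda k.u:A^{\mathsf q}$; $\Gamma\vdash p:A^{\mathsf p},\ \Gamma\rhd\delta\vdash t:A^{\mathsf t}\Rightarrow\Gamma\rhd\delta\vdash t;p$; $\Gamma\vdash q:A^{\mathsf q},\ \Gamma\rhd\delta\vdash t:A^{\mathsf t}\Rightarrow\Gamma\rhd\delta\vdash q\,t$. Call-by-Value translation: $x^{\mathrm v}=\overline\lambda k.k;x$; $(\lambda x.M)^{\mathrm v}=\overline\lambda k.k;(\lambda\langle x,k\rangle.M^{\mathrm v}k)$; $(MN)^{\mathrm v}=\overline\lambda k.N^{\mathrm v}(\lambda x.M^{\mathrm v}\langle x,k\rangle)$ with $x$ fresh. -}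

module Defs where

open import Data.Nat using (ℕ; zero; suc; _<ᵇ_)
open import Data.Bool using (if_then_else_)
open import Data.List using (List; []; _∷_)

data Ty : Set where
  `_  : ℕ → Ty
  _⇒_ : Ty → Ty → Ty

infixr 7 _⇒_

-- contexts (variables as de Bruijn indices; index 0 = last entry)
Ctx : Set
Ctx = List Ty

data _∋_∶_ : Ctx → ℕ → Ty → Set where
  here  : ∀ {Γ A} → (A ∷ Γ) ∋ zero ∶ A
  there : ∀ {Γ A B n} → Γ ∋ n ∶ A → (B ∷ Γ) ∋ suc n ∶ A

data Tm : Set where
  var : ℕ → Tm
  lam : Tm → Tm
  app : Tm → Tm → Tm

data _⊢_∶_ : Ctx → Tm → Ty → Set where
  ⊢var : ∀ {Γ n A} → Γ ∋ n ∶ A → Γ ⊢ var n ∶ A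
  ⊢lam : ∀ {Γ M A B} → (A ∷ Γ) ⊢ M ∶ B → Γ ⊢ lam M ∶ (A ⇒ B)
  ⊢app : ∀ {Γ M N A B} → Γ ⊢ M ∶ (A ⇒ B) → Γ ⊢ N ∶ A → Γ ⊢ app M N ∶ B

-- ptq-calculus syntax (p-variables as de Bruijn indices; the single
-- t-variable k is rebound by λ⟨x,k⟩, λk and λ̄k)

mutual
  data PTm : Set where
    pvar  : ℕ → PTm
    plam⟨⟩ : ETm → PTm        -- λ⟨x,k⟩.u   (binds x and k)
    plamk : ETm → PTm

  data TTm : Set where
    star : TTm
    kvar : TTm
    ⟨_,_⟩ : PTm → TTm → TTm
    tlam : ETm → TTm         -- λx.u       (binds x)

  data QTm : Set where
    qlam : ETm → QTm

  data ETm : Set where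
    _⨾_  : TTm → PTm → ETm
    _·_  : QTm → TTm → ETm

-- ptq typing.  A proof-context Γ is a list of types, each entry x:A
-- standing for x:A^p.  δ is either k:A^t or *:A^t.

PCtx : Set
PCtx = List Ty

_ᵖ : Ctx → PCtx
[] ᵖ = []
(A ∷ Γ) ᵖ = A ∷ (Γ ᵖ)

data Δ : Set where
  k∶_ : Ty → Δ
  *∶_ : Ty → Δ

mutual
  data _⊢ₚ_∶_ : PCtx → PTm → Ty → Set where
    ⊢x     : ∀ {Γ n A} → Γ ∋ n ∶ A → Γ ⊢ₚ pvar n ∶ A
    ⊢λ⟨⟩   : ∀ {Γ u A B} → (A ∷ Γ) ▷ (k∶ B) ⊢ₑ u → Γ ⊢ₚ plam⟨⟩ u ∶ (A ⇒ B)
    ⊢λk    : ∀ {Γ u A} → Γ ▷ (k∶ A) ⊢ₑ u → Γ ⊢ₚ plamk u ∶ A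

  data _▷_⊢ₜ_∶_ : PCtx → Δ → TTm → Ty → Set where
    ⊢k     : ∀ {Γ A} → Γ ▷ (k∶ A) ⊢ₜ kvar ∶ A
    ⊢*     : ∀ {Γ A} → Γ ▷ (*∶ A) ⊢ₜ star ∶ A
    ⊢⟨⟩    : ∀ {Γ δ p t A B} → Γ ⊢ₚ p ∶ A → Γ ▷ δ ⊢ₜ t ∶ B →
             Γ ▷ δ ⊢ₜ ⟨ p , t ⟩ ∶ (A ⇒ B)
    ⊢λx    : ∀ {Γ δ u A} → (A ∷ Γ) ▷ δ ⊢ₑ u → Γ ▷ δ ⊢ₜ tlam u ∶ A

  data _⊢q_∶_ : PCtx → QTm → Ty → Set where
    ⊢λ̄k    : ∀ {Γ u A} → Γ ▷ (k∶ A) ⊢ₑ u → Γ ⊢q qlam u ∶ A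

  data _▷_⊢ₑ_ : PCtx → Δ → ETm → Set where
    ⊢⨾     : ∀ {Γ δ p t A} → Γ ⊢ₚ p ∶ A → Γ ▷ δ ⊢ₜ t ∶ A → Γ ▷ δ ⊢ₑ (t ⨾ p)
    ⊢·     : ∀ {Γ δ q t A} → Γ ⊢q q ∶ A → Γ ▷ δ ⊢ₜ t ∶ A → Γ ▷ δ ⊢ₑ (q · t)

shiftVar : ℕ → ℕ → ℕ
shiftVar c n = if n <ᵇ c then n else suc n

mutual
  shiftP : ℕ → PTm → PTm
  shiftP c (pvar n)   = pvar (shiftVar c n)
  shiftP c (plam⟨⟩ u) = plam⟨⟩ (shiftE (suc c) u)
  shiftP c (plamk u)  = plamk (shiftE c u)

  shiftT : ℕ → TTm → TTm
  shiftT c star        = star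
  shiftT c kvar        = kvar
  shiftT c ⟨ p , t ⟩   = ⟨ shiftP c p , shiftT c t ⟩
  shiftT c (tlam u)    = tlam (shiftE (suc c) u)

  shiftQ : ℕ → QTm → QTm
  shiftQ c (qlam u) = qlam (shiftE c u)

  shiftE : ℕ → ETm → ETm
  shiftE c (t ⨾ p) = shiftT c t ⨾ shiftP c p
  shiftE c (q · t) = shiftQ c q · shiftT c t

-- Call-by-value translation
--   x^v       = λ̄k. k;x
--   (λx.M)^v  = λ̄k. k;(λ⟨x,k⟩. M^v k)
--   (M N)^v   = λ̄k. N^v (λx. M^v ⟨x,k⟩)     (x fresh: M^v shifted)

_ᵛ : Tm → QTm
var n ᵛ   = qlam (kvar ⨾ pvar n)
lam M ᵛ   = qlam (kvar ⨾ plam⟨⟩ ((M ᵛ) · kvar))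
app M N ᵛ = qlam ((N ᵛ) · tlam (shiftQ 0 (M ᵛ) · ⟨ pvar 0 , kvar ⟩))

module Submission where

open import Defs
open import Data.Nat using (ℕ; zero; suc; _<ᵇ_)
open import Data.Bool using (true; false)
open import Data.List using ([]; _∷_)
open import Relation.Binary.PropositionalEquality using (_≡_; refl; subst; sym)

-- Each clause of the translation is typed by the rule of the same shape; the
-- only non-structural step is the application case, where M^v is moved under
-- the binder λx and so needs weakening of the ptq judgements.

-- Inserting B at position c; a cutoff beyond the end appends B.
insertAt : ℕ → Ty → PCtx → PCtx
insertAt zero    B Γ       = B ∷ Γ
insertAt (suc c) B []      = B ∷ []
insertAt (suc c) B (A ∷ Γ) = A ∷ insertAt c B Γ

shiftVar-suc : ∀ c n → shiftVar (suc c) (suc n) ≡ suc (shiftVar c n)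
shiftVar-suc c n with n <ᵇ c
... | true  = refl
... | false = refl

∋-weaken : ∀ {Γ n A} c B → Γ ∋ n ∶ A → insertAt c B Γ ∋ shiftVar c n ∶ A
∋-weaken zero    B here      = there here
∋-weaken zero    B (there x) = there (there x)
∋-weaken (suc c) B here      = here
∋-weaken {A ∷ Γ} {suc n} {C} (suc c) B (there x) =
  subst (λ m → insertAt (suc c) B (A ∷ Γ) ∋ m ∶ C)
        (sym (shiftVar-suc c n)) (there (∋-weaken c B x))

mutual
  ⊢ₚ-weaken : ∀ {Γ p A} c B → Γ ⊢ₚ p ∶ A → insertAt c B Γ ⊢ₚ shiftP c p ∶ A
  ⊢ₚ-weaken c B (⊢x x)   = ⊢x (∋-weaken c B x)
  ⊢ₚ-weaken c B (⊢λ⟨⟩ u) = ⊢λ⟨⟩ (⊢ₑ-weaken (suc c) B u)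
  ⊢ₚ-weaken c B (⊢λk u)  = ⊢λk (⊢ₑ-weaken c B u)

  ⊢ₜ-weaken : ∀ {Γ δ t A} c B → Γ ▷ δ ⊢ₜ t ∶ A → insertAt c B Γ ▷ δ ⊢ₜ shiftT c t ∶ A
  ⊢ₜ-weaken c B ⊢k        = ⊢k
  ⊢ₜ-weaken c B ⊢*        = ⊢*
  ⊢ₜ-weaken c B (⊢⟨⟩ p t) = ⊢⟨⟩ (⊢ₚ-weaken c B p) (⊢ₜ-weaken c B t)
  ⊢ₜ-weaken c B (⊢λx u)   = ⊢λx (⊢ₑ-weaken (suc c) B u)

  ⊢q-weaken : ∀ {Γ q A} c B → Γ ⊢q q ∶ A → insertAt c B Γ ⊢q shiftQ c q ∶ A
  ⊢q-weaken c B (⊢λ̄k u) = ⊢λ̄k (⊢ₑ-weaken c B u)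

  ⊢ₑ-weaken : ∀ {Γ δ u} c B → Γ ▷ δ ⊢ₑ u → insertAt c B Γ ▷ δ ⊢ₑ shiftE c u
  ⊢ₑ-weaken c B (⊢⨾ p t) = ⊢⨾ (⊢ₚ-weaken c B p) (⊢ₜ-weaken c B t)
  ⊢ₑ-weaken c B (⊢· q t) = ⊢· (⊢q-weaken c B q) (⊢ₜ-weaken c B t)

∋-ᵖ : ∀ {Γ n A} → Γ ∋ n ∶ A → (Γ ᵖ) ∋ n ∶ A
∋-ᵖ here      = here
∋-ᵖ (there x) = there (∋-ᵖ x)

proposition6 : ∀ {Γ : Ctx} {M : Tm} {A : Ty} → Γ ⊢ M ∶ A → (Γ ᵖ) ⊢q (M ᵛ) ∶ A
proposition6 (⊢var x) = ⊢λ̄k (⊢⨾ (⊢x (∋-ᵖ x)) ⊢k)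
proposition6 (⊢lam M) = ⊢λ̄k (⊢⨾ (⊢λ⟨⟩ (⊢· (proposition6 M) ⊢k)) ⊢k)
proposition6 (⊢app {A = A} M N) =
  ⊢λ̄k (⊢· (proposition6 N)
           (⊢λx (⊢· (⊢q-weaken 0 A (proposition6 M)) (⊢⟨⟩ (⊢x here) ⊢k))))
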